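{- Every S-function $f:\mathcal{G}\to\mathbb{N}$ gives rise to an S-functor $F$ over the spined category $(\mathbf{Grph}_{mono},(K_n)_{n\in\mathbb{N}},\#)$ satisfying $F(X)=f(X)$ for every graph $X$.
   Context: $\mathcal{G}$ is the class of finite graphs without loops or parallel edges; $\mathbb{N}=\{0,1,\dots\}$; $K_n$ is the complete graph on $n$ vertices ($K_0$ the empty graph). $G\star v$ denotes $G$ with a new vertex $v$ adjacent to all vertices of $G$. For graphs $G_1,G_2$ and injective homomorphisms $K_n\to G_1$, $K_n\to G_2$, $G_1\#_{K_n}G_2$ is obtained from the disjoint union by identifying the two images of each vertex of $K_n$ and removing parallel edges (clique sum). An S-function (Halin) is $f:\mathcal{G}\to\mathbb{N}$ with (H1) $f(K_0)=0$; (H2) $f(H)\le f(G)$ whenever $H$ is a minor of $G$; (H3) $f(G\star v)=1+f(G)$; (H4) for every $n$, $G=G_1\#_{K_n}G_2$ implies $f(G)=\max\{f(G_1),f(G_2)\}$. $\mathbf{Grph}_{mono}$ is the category of graphs and injective homomorphisms, a spined category with spine $\Omega_n=K_n$ and proxy pushout sending a span $G\xleftarrow{g}K_n\xrightarrow{h}H$ to $G\#_{K_n}H$ with canonical inclusions. An S-functor over it is a functor $F$ from $\mathbf{Grph}_{mono}$ to the poset $(\mathbb{N},\le)$ (so $F(X)\le F(Y)$ whenever an injective homomorphism $X\to Y$ exists) with $F(K_n)=n$ for all $n$ and $F(G\#_{K_n}H)=\max\{F(G),F(H)\}$ for all such spans. -}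

module Defs where

open import Data.Nat using (ℕ; zero; suc; _⊔_; _≤_)
open import Data.Fin using (Fin; zero; suc)
open import Data.Fin.Properties using (_≟_)
open import Data.Bool using (Bool; true; false; not)
open import Data.Maybe using (Maybe; just)
open import Data.Product using (Σ; ∃; _×_; _,_)
open import Data.Sum using (_⊎_)
open import Relation.Nullary using (yes; no)
open import Relation.Nullary.Decidable using (⌊_⌋)
open import Relation.Binary.PropositionalEquality using (_≡_; refl; sym)

record Graph : Set where
  field
    size   : ℕ
    adj    : Fin size → Fin size → Bool
    adj-sym    : ∀ x y → adj x y ≡ adj y x
    adj-irrefl : ∀ x → adj x x ≡ false
open Graph public

V : Graph → Set
V G = Fin (size G)

Edge : (G : Graph) → V G → V G → Set
Edge G x y = adj G x y ≡ true

private
  neq : ∀ {n} → Fin n → Fin n → Bool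
  neq x y = not ⌊ x ≟ y ⌋

  neq-sym : ∀ {n} (x y : Fin n) → neq x y ≡ neq y x
  neq-sym x y with x ≟ y | y ≟ x
  ... | yes _ | yes _ = refl
  ... | no _  | no _  = refl
  ... | yes p | no q = Data.Empty.⊥-elim (q (sym p)) where import Data.Empty
  ... | no q  | yes p = Data.Empty.⊥-elim (q (sym p)) where import Data.Empty

  neq-irrefl : ∀ {n} (x : Fin n) → neq x x ≡ false
  neq-irrefl x with x ≟ x
  ... | yes _ = refl
  ... | no q = Data.Empty.⊥-elim (q refl) where import Data.Empty

K : ℕ → Graph
K n = record { size = n ; adj = neq ; adj-sym = neq-sym ; adj-irrefl = neq-irrefl }

-- G ⋆ v : new vertex (zero) adjacent to all vertices of G
private
  coneAdj : (G : Graph) → Fin (suc (size G)) → Fin (suc (size G)) → Bool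
  coneAdj G zero zero = false
  coneAdj G zero (suc _) = true
  coneAdj G (suc _) zero = true
  coneAdj G (suc i) (suc j) = adj G i j

  coneSym : (G : Graph) → ∀ x y → coneAdj G x y ≡ coneAdj G y x
  coneSym G zero zero = refl
  coneSym G zero (suc _) = refl
  coneSym G (suc _) zero = refl
  coneSym G (suc i) (suc j) = adj-sym G i j

  coneIrr : (G : Graph) → ∀ x → coneAdj G x x ≡ false
  coneIrr G zero = refl
  coneIrr G (suc i) = adj-irrefl G i

cone : Graph → Graph
cone G = record { size = suc (size G) ; adj = coneAdj G ; adj-sym = coneSym G ; adj-irrefl = coneIrr G }

record Mono (G H : Graph) : Set where
  field
    map      : V G → V H
    map-edge : ∀ x y → Edge G x y → Edge H (map x) (map y)
    map-inj  : ∀ x y → map x ≡ map y → x ≡ y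
open Mono public

-- Walks in G all of whose vertices after the first satisfy P
data Walk (G : Graph) (P : V G → Set) : V G → V G → Set where
  here : ∀ {u} → Walk G P u u
  step : ∀ {u v w} → Edge G u v → P v → Walk G P v w → Walk G P u w

-- H is a minor of G: a minor model with disjoint nonempty connected branch
-- sets β⁻¹(h) ⊆ V(G), and an edge of G between the branch sets of adjacent vertices of H.
record IsMinor (H G : Graph) : Set where
  field
    branch    : V G → Maybe (V H)
    nonempty  : ∀ h → ∃ λ u → branch u ≡ just h
    connected : ∀ h u v → branch u ≡ just h → branch v ≡ just h →
                Walk G (λ w → branch w ≡ just h) u v
    edges     : ∀ h h' → Edge H h h' →
                ∃ λ u → ∃ λ v → branch u ≡ just h × branch v ≡ just h' × Edge G u v

-- G is (isomorphic to) the clique sum G₁ #_{K_n} G₂ along g : K_n → G₁, h : K_n → G₂: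
-- G is covered by embedded copies of G₁ and G₂ glued exactly along the images of K_n,
-- and the edges of G are exactly the images of the edges of G₁ and of G₂.
record IsCliqueSum (G G₁ G₂ : Graph) (n : ℕ) (g : Mono (K n) G₁) (h : Mono (K n) G₂) : Set where
  field
    ι₁ : V G₁ → V G
    ι₂ : V G₂ → V G
    ι₁-inj : ∀ x y → ι₁ x ≡ ι₁ y → x ≡ y
    ι₂-inj : ∀ x y → ι₂ x ≡ ι₂ y → x ≡ y
    glue   : ∀ k → ι₁ (map g k) ≡ ι₂ (map h k)
    meet   : ∀ x y → ι₁ x ≡ ι₂ y → ∃ λ k → x ≡ map g k × y ≡ map h k
    cover  : ∀ u → (∃ λ x → ι₁ x ≡ u) ⊎ (∃ λ y → ι₂ y ≡ u)
    edges→ : ∀ u v → Edge G u v →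
             (∃ λ x → ∃ λ x' → ι₁ x ≡ u × ι₁ x' ≡ v × Edge G₁ x x')
             ⊎ (∃ λ y → ∃ λ y' → ι₂ y ≡ u × ι₂ y' ≡ v × Edge G₂ y y')
    edges₁ : ∀ x x' → Edge G₁ x x' → Edge G (ι₁ x) (ι₁ x')
    edges₂ : ∀ y y' → Edge G₂ y y' → Edge G (ι₂ y) (ι₂ y')

record IsSFunction (f : Graph → ℕ) : Set where
  field
    H1 : f (K 0) ≡ 0
    H2 : ∀ H G → IsMinor H G → f H ≤ f G
    H3 : ∀ G → f (cone G) ≡ suc (f G)
    H4 : ∀ n G G₁ G₂ (g : Mono (K n) G₁) (h : Mono (K n) G₂) →
         IsCliqueSum G G₁ G₂ n g h → f G ≡ f G₁ ⊔ f G₂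

-- S-functors over (Grph_mono, (K_n), #): functors into the poset (ℕ, ≤)
record IsSFunctor (F : Graph → ℕ) : Set where
  field
    functorial : ∀ X Y → Mono X Y → F X ≤ F Y
    spine      : ∀ n → F (K n) ≡ n
    pushout    : ∀ n G G₁ G₂ (g : Mono (K n) G₁) (h : Mono (K n) G₂) →
                 IsCliqueSum G G₁ G₂ n g h → F G ≡ F G₁ ⊔ F G₂

-- Take F := f. An injective homomorphism X → Y exhibits X as a minor of Y
-- (singleton branch sets), so (H2) makes f a functor into (ℕ, ≤); since
-- K (n + 1) ≅ K n ⋆ v, (H1) and (H3) give f (K n) = n by induction on n; and the
-- clique-sum condition is (H4) itself.
module Submission where

open import Defs
open import Data.Nat using (ℕ; zero; suc; _≤_)
open import Data.Nat.Properties using (≤-antisym)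
open import Data.Fin using (Fin; zero; suc)
open import Data.Fin.Properties using (_≟_; suc-injective; any?)
open import Data.Bool using (not)
open import Data.Maybe using (Maybe; just; nothing)
open import Data.Product using (Σ; _×_; _,_)
open import Data.Empty using (⊥-elim)
open import Relation.Nullary using (yes; no)
open import Relation.Nullary.Decidable using (⌊⌋-map′)
open import Relation.Binary.PropositionalEquality
  using (_≡_; refl; sym; trans; cong; module ≡-Reasoning)

preimage : ∀ {n k} → (Fin n → Fin k) → Fin k → Maybe (Fin n)
preimage m u with any? (λ x → m x ≟ u)
... | yes (x , _) = just x
... | no _        = nothing

preimage-sound : ∀ {n k} (m : Fin n → Fin k) u x → preimage m u ≡ just x → m x ≡ u
preimage-sound m u x eq with any? (λ x → m x ≟ u)
preimage-sound m u x refl | yes (.x , mx≡u) = mx≡u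

preimage-injective : ∀ {n k} (m : Fin n → Fin k) → (∀ x y → m x ≡ m y → x ≡ y) →
                     ∀ x → preimage m (m x) ≡ just x
preimage-injective m m-inj x with any? (λ y → m y ≟ m x)
... | yes (y , my≡mx) = cong just (m-inj y x my≡mx)
... | no ∄y           = ⊥-elim (∄y (x , refl))

Mono⇒IsMinor : ∀ {X Y} → Mono X Y → IsMinor X Y
Mono⇒IsMinor {X} {Y} φ = record
  { branch    = preimage (map φ)
  ; nonempty  = λ h → map φ h , branch-map h
  ; connected = connected
  ; edges     = λ h h' e → map φ h , map φ h' , branch-map h , branch-map h' , map-edge φ h h' e
  }
  where
  branch-map : ∀ h → preimage (map φ) (map φ h) ≡ just h
  branch-map = preimage-injective (map φ) (map-inj φ)

  connected : ∀ h u v → preimage (map φ) u ≡ just h → preimage (map φ) v ≡ just h →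
              Walk Y (λ w → preimage (map φ) w ≡ just h) u v
  connected h u v bu bv
    with trans (sym (preimage-sound (map φ) u h bu)) (preimage-sound (map φ) v h bv)
  ... | refl = here

cone-K≗K-suc : ∀ n (x y : Fin (suc n)) → adj (cone (K n)) x y ≡ adj (K (suc n)) x y
cone-K≗K-suc n zero    zero    = refl
cone-K≗K-suc n zero    (suc y) = refl
cone-K≗K-suc n (suc x) zero    = refl
cone-K≗K-suc n (suc x) (suc y) =
  cong not (sym (⌊⌋-map′ (cong suc) suc-injective (x ≟ y)))

cone-K↣K-suc : ∀ n → Mono (cone (K n)) (K (suc n))
cone-K↣K-suc n = record
  { map      = λ x → x
  ; map-edge = λ x y e → trans (sym (cone-K≗K-suc n x y)) e
  ; map-inj  = λ _ _ p → p
  }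

K-suc↣cone-K : ∀ n → Mono (K (suc n)) (cone (K n))
K-suc↣cone-K n = record
  { map      = λ x → x
  ; map-edge = λ x y e → trans (cone-K≗K-suc n x y) e
  ; map-inj  = λ _ _ p → p
  }

minor-monotone-↣-both-ways : ∀ {f : Graph → ℕ} → (∀ H G → IsMinor H G → f H ≤ f G) →
                             ∀ {X Y} → Mono X Y → Mono Y X → f X ≡ f Y
minor-monotone-↣-both-ways mono φ ψ =
  ≤-antisym (mono _ _ (Mono⇒IsMinor φ)) (mono _ _ (Mono⇒IsMinor ψ))

IsSFunction-K : ∀ {f} → IsSFunction f → ∀ n → f (K n) ≡ n
IsSFunction-K     S zero    = IsSFunction.H1 S
IsSFunction-K {f} S (suc n) = begin
  f (K (suc n))     ≡⟨ minor-monotone-↣-both-ways H2 (K-suc↣cone-K n) (cone-K↣K-suc n) ⟩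
  f (cone (K n))    ≡⟨ H3 (K n) ⟩
  suc (f (K n))     ≡⟨ cong suc (IsSFunction-K S n) ⟩
  suc n             ∎
  where
  open IsSFunction S
  open ≡-Reasoning

proposition3p7 : (f : Graph → ℕ) → IsSFunction f →
    Σ (Graph → ℕ) (λ F → IsSFunctor F × ((X : Graph) → F X ≡ f X))
proposition3p7 f S = f , isSFunctor , λ _ → refl
  where
  open IsSFunction S
  isSFunctor : IsSFunctor f
  isSFunctor = record
    { functorial = λ X Y φ → H2 X Y (Mono⇒IsMinor φ)
    ; spine      = IsSFunction-K S
    ; pushout    = H4
    }
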